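{- Let $M$ be the generic poset, let $v \in M$, and let $f \in \mathrm{Aut}(M)$ fix every element of $v^+ = \{m \in M : m \geq v\}$. Then $f = \mathrm{id}_M$.
   Context: The generic poset $M$ is the Fraïssé limit of the class of all finite posets: the unique countable ultrahomogeneous poset into which every finite poset embeds. -}

module Defs where

open import Data.Nat using (ℕ)
open import Data.Fin using (Fin)
open import Data.Product using (Σ; ∃; _×_; _,_)
open import Relation.Binary.PropositionalEquality using (_≡_)
open import Relation.Binary.Structures using (IsPartialOrder)
open import Function.Base using (_∘_)
open import Function.Definitions using (Injective)
open import Function.Bundles using (_⇔_)

record PosetOn (A : Set) : Set₁ where
  field
    _≤_ : A → A → Set
    isPartialOrder : IsPartialOrder _≡_ _≤_

record FinPoset : Set₁ where
  field
    size  : ℕ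
    order : PosetOn (Fin size)

module _ {A : Set} (P : PosetOn A) where
  open PosetOn P

  record Aut : Set where
    field
      to      : A → A
      from    : A → A
      to∘from : ∀ x → to (from x) ≡ x
      from∘to : ∀ x → from (to x) ≡ x
      order   : ∀ x y → (x ≤ y) ⇔ (to x ≤ to y)

  Countable : Set
  Countable = Σ (A → ℕ) λ c → Injective _≡_ _≡_ c

  Universal : Set₁
  Universal = (Q : FinPoset) →
    let open FinPoset Q
        open PosetOn order renaming (_≤_ to _≼_)
    in Σ (Fin size → A) λ e →
         Injective _≡_ _≡_ e × (∀ i j → (i ≼ j) ⇔ (e i ≤ e j))

  -- Ultrahomogeneous: every isomorphism between finite substructures
  -- (given as an enumeration g of the domain and h of the image, with
  -- g i ↦ h i order-isomorphic) extends to an automorphism.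
  Ultrahomogeneous : Set
  Ultrahomogeneous = (n : ℕ) (g h : Fin n → A) →
    (∀ i j → (g i ≤ g j) ⇔ (h i ≤ h j)) →
    Σ Aut λ σ → ∀ i → Aut.to σ (g i) ≡ h i

record IsGenericPoset {A : Set} (P : PosetOn A) : Set₁ where
  field
    countable        : Countable P
    universal        : Universal P
    ultrahomogeneous : Ultrahomogeneous P

{-# OPTIONS --safe #-}
module Submission where

-- A fixed point m of an automorphism f satisfies x ≤ m ⇔ f x ≤ m, so it never lies
-- above exactly one of x and f x.  If f x ≠ x, one of the two is not below the other,
-- and a one-point extension of a finite subposet of M yields a fixed m above that one
-- but not above the other: first an m above v, showing that f fixes every x ≰ v, and
-- then an m ≰ v, handling every remaining x ≠ v.  Equality on M is decidable since M is
-- countable, so refuting f x ≠ x suffices.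

open import Defs
open import Data.Empty using (⊥; ⊥-elim)
open import Data.Fin using (Fin; zero; suc)
open import Data.Nat using (ℕ; suc)
import Data.Nat.Properties as ℕ
open import Data.Product using (_×_; _,_; ∃-syntax)
open import Data.Sum using (_⊎_; inj₁; inj₂; [_,_])
open import Data.Unit using (⊤; tt)
open import Function.Base using (_∘_)
open import Function.Bundles using (_⇔_; Equivalence)
open import Function.Definitions using (Injective)
open import Function.Properties.Equivalence using () renaming (trans to ⇔-trans; sym to ⇔-sym)
open import Relation.Binary.Definitions using (DecidableEquality)
open import Relation.Binary.PropositionalEquality
  using (_≡_; _≢_; refl; sym; trans; cong; subst; isEquivalence)
open import Relation.Binary.Structures using (IsPartialOrder)
open import Relation.Nullary using (¬_; Dec; yes; no)
open import Relation.Nullary.Decidable using (map′; decidable-stable)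

countable⇒decidableEquality : {A : Set} (P : PosetOn A) → Countable P → DecidableEquality A
countable⇒decidableEquality _ (c , c-injective) x y = map′ c-injective (cong c) (c x ℕ.≟ c y)

module AutomorphismFixedPoints {A : Set} {P : PosetOn A} (f : Aut P) where
  open PosetOn P
  open IsPartialOrder isPartialOrder using (antisym)
  open Aut f using (to; from; from∘to; order)

  to-injective : Injective _≡_ _≡_ to
  to-injective {x} {y} fx≡fy = trans (sym (from∘to x)) (trans (cong from fx≡fy) (from∘to y))

  ≢-fixed : ∀ {m x} → to m ≡ m → m ≢ x → m ≢ to x
  ≢-fixed fm≡m m≢x m≡fx = m≢x (to-injective (trans fm≡m m≡fx))

  ≤-fixed⇔ : ∀ {m x} → to m ≡ m → x ≤ m ⇔ to x ≤ m
  ≤-fixed⇔ {m} {x} fm≡m = subst (λ y → x ≤ m ⇔ to x ≤ y) fm≡m (order x m)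

  FixedSeparator : A → A → Set
  FixedSeparator p q = ∃[ m ] to m ≡ m × p ≤ m × ¬ q ≤ m

  ¬FixedSeparator[x,fx] : ∀ x → ¬ FixedSeparator x (to x)
  ¬FixedSeparator[x,fx] x (m , fm≡m , x≤m , fx≰m) = fx≰m (Equivalence.to (≤-fixed⇔ fm≡m) x≤m)

  ¬FixedSeparator[fx,x] : ∀ x → ¬ FixedSeparator (to x) x
  ¬FixedSeparator[fx,x] x (m , fm≡m , fx≤m , x≰m) = x≰m (Equivalence.from (≤-fixed⇔ fm≡m) fx≤m)

  fixed-if-separated : (S : A → Set) →
    (∀ {p q} → S p → S q → ¬ q ≤ p → FixedSeparator p q) →
    ∀ {x} → S x → S (to x) → ¬ ¬ to x ≡ x
  fixed-if-separated S separate {x} Sx Sfx fx≢x =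
    ¬FixedSeparator[fx,x] x (separate Sfx Sx λ x≤fx →
      ¬FixedSeparator[x,fx] x (separate Sx Sfx λ fx≤x → fx≢x (antisym fx≤x x≤fx)))

module GenericPoset {M : Set} (P : PosetOn M) (G : IsGenericPoset P) where
  open PosetOn P
  open IsPartialOrder isPartialOrder using (antisym) renaming (refl to ≤-refl; trans to ≤-trans)
  open IsGenericPoset G

  module _ {n : ℕ} (a : Fin n → M) (a-injective : Injective _≡_ _≡_ a)
           (D : M → Set) (D-downward : ∀ {x y} → x ≤ y → D y → D x) where

    -- zero is the new point, lying above exactly those a i with D (a i).
    _⊑_ : Fin (suc n) → Fin (suc n) → Set
    zero  ⊑ zero  = ⊤
    zero  ⊑ suc j = ⊥
    suc i ⊑ zero  = D (a i)
    suc i ⊑ suc j = a i ≤ a j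

    ⊑-reflexive : ∀ {i j} → i ≡ j → i ⊑ j
    ⊑-reflexive {zero}  refl = tt
    ⊑-reflexive {suc i} refl = ≤-refl

    ⊑-trans : ∀ {i j k} → i ⊑ j → j ⊑ k → i ⊑ k
    ⊑-trans {zero}  {zero}  {zero}  _   _   = tt
    ⊑-trans {suc i} {zero}  {zero}  i⊑j _   = i⊑j
    ⊑-trans {suc i} {suc j} {zero}  i≤j Dj  = D-downward i≤j Dj
    ⊑-trans {suc i} {suc j} {suc k} i≤j j≤k = ≤-trans i≤j j≤k

    ⊑-antisym : ∀ {i j} → i ⊑ j → j ⊑ i → i ≡ j
    ⊑-antisym {zero}  {zero}  _   _   = refl
    ⊑-antisym {suc i} {suc j} i≤j j≤i = cong suc (a-injective (antisym i≤j j≤i))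

    extendedPoset : FinPoset
    extendedPoset = record
      { size  = suc n
      ; order = record
        { _≤_            = _⊑_
        ; isPartialOrder = record
          { isPreorder = record
            { isEquivalence = isEquivalence
            ; reflexive     = ⊑-reflexive
            ; trans         = λ {i} {j} {k} → ⊑-trans {i} {j} {k}
            }
          ; antisym = ⊑-antisym
          }
        }
      }

    one-point-extension : ∃[ m ] (∀ i → a i ≤ m ⇔ D (a i)) × (∀ i → ¬ m ≤ a i)
    one-point-extension with universal extendedPoset
    ... | e , _ , e-order
        with ultrahomogeneous n (e ∘ suc) a (λ i j → ⇔-sym (e-order (suc i) (suc j)))
    ... | σ , σe≡a = to (e zero) , below , not-below
      where
        open Aut σ using (to; order)

        below : ∀ i → a i ≤ to (e zero) ⇔ D (a i)
        below i = subst (λ y → y ≤ to (e zero) ⇔ D (a i)) (σe≡a i)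
          (⇔-trans (⇔-sym (order (e (suc i)) (e zero))) (⇔-sym (e-order (suc i) zero)))

        not-below : ∀ i → ¬ to (e zero) ≤ a i
        not-below i m≤ai = Equivalence.from (e-order zero (suc i))
          (Equivalence.from (order (e zero) (e (suc i))) (subst (to (e zero) ≤_) (sym (σe≡a i)) m≤ai))

  triple : M → M → M → Fin 3 → M
  triple x y z zero             = x
  triple x y z (suc zero)       = y
  triple x y z (suc (suc zero)) = z

  triple-injective : ∀ {x y z} → x ≢ y → x ≢ z → y ≢ z → Injective _≡_ _≡_ (triple x y z)
  triple-injective _   _   _   {zero}             {zero}             _   = refl
  triple-injective _   _   _   {suc zero}         {suc zero}         _   = refl
  triple-injective _   _   _   {suc (suc zero)}   {suc (suc zero)}   _   = refl
  triple-injective x≢y _   _   {zero}             {suc zero}         x≡y = ⊥-elim (x≢y x≡y)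
  triple-injective x≢y _   _   {suc zero}         {zero}             y≡x = ⊥-elim (x≢y (sym y≡x))
  triple-injective _   x≢z _   {zero}             {suc (suc zero)}   x≡z = ⊥-elim (x≢z x≡z)
  triple-injective _   x≢z _   {suc (suc zero)}   {zero}             z≡x = ⊥-elim (x≢z (sym z≡x))
  triple-injective _   _   y≢z {suc zero}         {suc (suc zero)}   y≡z = ⊥-elim (y≢z y≡z)
  triple-injective _   _   y≢z {suc (suc zero)}   {suc zero}         z≡y = ⊥-elim (y≢z (sym z≡y))

  ≰⇒≢ : ∀ {x y} → ¬ x ≤ y → y ≢ x
  ≰⇒≢ {x} x≰y y≡x = x≰y (subst (x ≤_) (sym y≡x) ≤-refl)

  upper-bound-avoiding : ∀ {v p q} → ¬ p ≤ v → ¬ q ≤ v → ¬ q ≤ p →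
    ∃[ m ] v ≤ m × p ≤ m × ¬ q ≤ m
  upper-bound-avoiding {v} {p} {q} p≰v q≰v q≰p
    with one-point-extension (triple v p q) (triple-injective (≰⇒≢ p≰v) (≰⇒≢ q≰v) (≰⇒≢ q≰p))
           (λ x → x ≤ v ⊎ x ≤ p) (λ x≤y → [ inj₁ ∘ ≤-trans x≤y , inj₂ ∘ ≤-trans x≤y ])
  ... | m , below , _ =
    m , Equivalence.from (below zero) (inj₁ ≤-refl) ,
    Equivalence.from (below (suc zero)) (inj₂ ≤-refl) ,
    [ q≰v , q≰p ] ∘ Equivalence.to (below (suc (suc zero)))

  upper-bound-avoiding-not-below : ∀ {v p q} → v ≢ p → v ≢ q → ¬ q ≤ p →
    ∃[ m ] p ≤ m × ¬ q ≤ m × ¬ m ≤ v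
  upper-bound-avoiding-not-below {v} {p} {q} v≢p v≢q q≰p
    with one-point-extension (triple v p q) (triple-injective v≢p v≢q (≰⇒≢ q≰p))
           (_≤ p) ≤-trans
  ... | m , below , not-below =
    m , Equivalence.from (below (suc zero)) ≤-refl ,
    q≰p ∘ Equivalence.to (below (suc (suc zero))) ,
    not-below zero

module AutomorphismFixingUpSet {M : Set} (P : PosetOn M) (G : IsGenericPoset P) (v : M) (f : Aut P)
         (fixes-↑v : ∀ m → PosetOn._≤_ P v m → Aut.to f m ≡ m) where
  open PosetOn P
  open IsPartialOrder isPartialOrder using () renaming (refl to ≤-refl)
  open GenericPoset P G
  open AutomorphismFixedPoints f
  open Aut f using (to)

  _≟_ : DecidableEquality M
  _≟_ = countable⇒decidableEquality P (IsGenericPoset.countable G)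

  ≡-stable : ∀ {x y} → ¬ ¬ x ≡ y → x ≡ y
  ≡-stable {x} {y} = decidable-stable (x ≟ y)

  fixes-v : to v ≡ v
  fixes-v = fixes-↑v v ≤-refl

  fixes-outside-↓v : ∀ {x} → ¬ x ≤ v → to x ≡ x
  fixes-outside-↓v x≰v =
    ≡-stable (fixed-if-separated (λ y → ¬ y ≤ v) separate x≰v (x≰v ∘ Equivalence.from (≤-fixed⇔ fixes-v)))
    where
      separate : ∀ {p q} → ¬ p ≤ v → ¬ q ≤ v → ¬ q ≤ p → FixedSeparator p q
      separate p≰v q≰v q≰p with upper-bound-avoiding p≰v q≰v q≰p
      ... | m , v≤m , p≤m , q≰m = m , fixes-↑v m v≤m , p≤m , q≰m

  fixes-all-but-v : ∀ {x} → v ≢ x → to x ≡ x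
  fixes-all-but-v v≢x = ≡-stable (fixed-if-separated (v ≢_) separate v≢x (≢-fixed fixes-v v≢x))
    where
      separate : ∀ {p q} → v ≢ p → v ≢ q → ¬ q ≤ p → FixedSeparator p q
      separate v≢p v≢q q≰p with upper-bound-avoiding-not-below v≢p v≢q q≰p
      ... | m , p≤m , q≰m , m≰v = m , fixes-outside-↓v m≰v , p≤m , q≰m

lemma5p4 : {M : Set} (P : PosetOn M) → IsGenericPoset P →
    (v : M) (f : Aut P) →
    (∀ m → PosetOn._≤_ P v m → Aut.to f m ≡ m) →
    ∀ x → Aut.to f x ≡ x
lemma5p4 P G v f fixes-↑v x = by-cases (v ≟ x)
  where
    open AutomorphismFixingUpSet P G v f fixes-↑v

    by-cases : Dec (v ≡ x) → Aut.to f x ≡ x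
    by-cases (yes refl) = fixes-v
    by-cases (no v≢x)   = fixes-all-but-v v≢x
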